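{- Let $N$ be a positive integer. Then $N\in\mathcal{U}$ if and only if $|E_N| = 2|E_{N-1}|$.
   Context: For $N\ge 0$, $E_N := \big\{\sum_{n=1}^N t_n/n : t_1,\dots,t_N\in\{0,1\}\big\}$ (so $E_0=\{0\}$). $\mathcal{U}$ is the set of positive integers $N$ such that $\sum_{n=1}^{N-1} w_n/n \ne 1/N$ for all choices $w_1,\dots,w_{N-1}\in\{ -1,0,+1\}$. -}

module Defs where

open import Data.Nat using (ℕ; zero; suc; _*_)
open import Data.Bool using (Bool; true; false)
open import Data.Integer using (+_)
open import Data.Rational using (ℚ; 0ℚ; _+_; -_; _/_)
open import Data.Rational.Properties using (_≟_)
open import Data.List using (List; []; _∷_; map; _++_; length; deduplicate)
open import Data.Vec using (Vec; []; _∷_)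
open import Data.Empty using (⊥)
open import Relation.Binary.PropositionalEquality using (_≡_)

recip : ℕ → ℚ
recip k = + 1 / suc k

wsumB : ∀ {m} → ℕ → Vec Bool m → ℚ
wsumB k []      = 0ℚ
wsumB k (b ∷ v) = (if' b) + wsumB (suc k) v
  where
  if' : Bool → ℚ
  if' false = 0ℚ
  if' true  = recip k

data Sign : Set where
  neg zer pos : Sign

wsumS : ∀ {m} → ℕ → Vec Sign m → ℚ
wsumS k []        = 0ℚ
wsumS k (neg ∷ v) = (- recip k) + wsumS (suc k) v
wsumS k (zer ∷ v) = wsumS (suc k) v
wsumS k (pos ∷ v) = recip k + wsumS (suc k) v

allBoolVecs : (n : ℕ) → List (Vec Bool n)
allBoolVecs zero    = [] ∷ []
allBoolVecs (suc n) = map (false ∷_) (allBoolVecs n) ++ map (true ∷_) (allBoolVecs n)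

-- E_N as a list (possibly with repetitions) of its elements Σ_{n=1}^N t_n/n
EList : ℕ → List ℚ
EList N = map (wsumB 0) (allBoolVecs N)

cardE : ℕ → ℕ
cardE N = length (deduplicate _≟_ (EList N))

InU : ℕ → Set
InU zero    = ⊥   -- 𝒰 consists of positive integers only
InU (suc m) = (w : Vec Sign m) → wsumS 0 w ≡ recip m → ⊥

-- Appending the last term splits E_N as E_{N-1} ∪ (E_{N-1} + 1/N), and the translate has
-- the same size as E_{N-1}; so |E_N| = 2|E_{N-1}| exactly when the two parts are disjoint.
-- They meet precisely when y = x + 1/N for some x, y ∈ E_{N-1}, and the differences y − x
-- of elements of E_{N-1} are exactly the signed sums Σ w_n/n with w_n ∈ {−1, 0, 1}.
module Submission where

open import Defs
open import Data.Nat using (ℕ; suc; _*_; _∸_; _≤_)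
open import Function.Bundles using (_⇔_)
open import Relation.Binary.PropositionalEquality using (_≡_)

open import Level using (Level)
open import Data.Nat using (_+_)
open import Data.Nat.Properties using (+-identityʳ; +-suc; +-cancelˡ-≡)
open import Data.Bool using (Bool; true; false; if_then_else_)
open import Data.Rational using (ℚ; 0ℚ) renaming (_+_ to _+ℚ_; _-_ to _-ℚ_)
open import Data.Rational.Properties as ℚ using (+-0-group) renaming (_≟_ to _≟ℚ_)
open import Data.Rational.Solver using (module +-*-Solver)
open import Algebra.Properties.Group +-0-group using (quasigroup)
open import Algebra.Properties.Quasigroup quasigroup using (cancelʳ)
open import Data.List using (List; map; _++_; length; filter; deduplicate)
open import Data.List.Properties using (length-map; length-++; filter-all; filter-complete)
open import Data.List.Membership.Propositional using (_∈_; _∉_)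
open import Data.List.Membership.Propositional.Properties
  using (∈-map⁺; ∈-map⁻; ∈-++⁺ˡ; ∈-++⁺ʳ; ∈-++⁻; ∈-filter⁺; ∈-filter⁻; deduplicate-∈⇔)
open import Data.List.Membership.Propositional.Properties.WithK using (unique∧set⇒bag)
open import Data.List.Relation.Binary.BagAndSetEquality using (∼bag⇒↭)
open import Data.List.Relation.Binary.Permutation.Propositional.Properties using (↭-length)
open import Data.List.Relation.Binary.Disjoint.Propositional using (Disjoint)
open import Data.List.Relation.Unary.Unique.Propositional using (Unique)
import Data.List.Relation.Unary.Unique.Propositional.Properties as Unique
open import Data.List.Relation.Unary.Unique.DecPropositional.Properties _≟ℚ_ using (deduplicate-!)
import Data.List.Relation.Unary.All as All
open import Data.List.Relation.Unary.Any using (here)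
open import Data.List.Relation.Unary.All.Properties using (all-filter)
open import Data.Vec as Vec using (Vec; []; _∷_; _∷ʳ_; initLast; zipWith)
open import Data.Product using (_,_; ∃-syntax; proj₁; proj₂)
open import Data.Sum using (_⊎_; inj₁; inj₂)
open import Function.Bundles using (mk⇔; Equivalence)
import Function.Properties.Equivalence as ⇔
open import Relation.Nullary using (yes; no)
open import Relation.Binary.Definitions using (DecidableEquality)
open import Relation.Binary.PropositionalEquality
  using (refl; sym; trans; cong; cong₂; subst; subst₂; module ≡-Reasoning)

open Equivalence using (to; from)

private
  variable
    a : Level
    A : Set a

Unique-set⇒length≡ : {xs ys : List A} → Unique xs → Unique ys →
                     (∀ {z} → z ∈ xs ⇔ z ∈ ys) → length xs ≡ length ys
Unique-set⇒length≡ xs! ys! xs≈ys = ↭-length (∼bag⇒↭ (unique∧set⇒bag xs! ys! xs≈ys))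

module Union (_≟_ : DecidableEquality A) where

  open import Data.List.Membership.DecPropositional _≟_ using (_∈?_; _∉?_)

  infixr 5 _∪_

  _∪_ : List A → List A → List A
  xs ∪ ys = xs ++ filter (_∉? xs) ys

  ∈-∪ : ∀ {xs ys z} → z ∈ xs ∪ ys ⇔ (z ∈ xs ⊎ z ∈ ys)
  ∈-∪ {xs} {ys} {z} = mk⇔ split join
    where
    split : z ∈ xs ∪ ys → z ∈ xs ⊎ z ∈ ys
    split z∈ with ∈-++⁻ xs z∈
    ... | inj₁ z∈xs = inj₁ z∈xs
    ... | inj₂ z∈new = inj₂ (proj₁ (∈-filter⁻ (_∉? xs) {xs = ys} z∈new))

    join : z ∈ xs ⊎ z ∈ ys → z ∈ xs ∪ ys
    join (inj₁ z∈xs) = ∈-++⁺ˡ z∈xs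
    join (inj₂ z∈ys) with z ∈? xs
    ... | yes z∈xs = ∈-++⁺ˡ z∈xs
    ... | no  z∉xs = ∈-++⁺ʳ xs (∈-filter⁺ (_∉? xs) z∈ys z∉xs)

  ∪-unique : ∀ {xs ys} → Unique xs → Unique ys → Unique (xs ∪ ys)
  ∪-unique {xs} {ys} xs! ys! = Unique.++⁺ xs! (Unique.filter⁺ (_∉? xs) ys!) fresh
    where
    fresh : Disjoint xs (filter (_∉? xs) ys)
    fresh (z∈xs , z∈new) = proj₂ (∈-filter⁻ (_∉? xs) {xs = ys} z∈new) z∈xs

  length-∪⇔Disjoint : ∀ xs ys → (length (xs ∪ ys) ≡ length xs + length ys) ⇔ Disjoint xs ys
  length-∪⇔Disjoint xs ys = mk⇔ disjoint additive
    where
    disjoint : length (xs ∪ ys) ≡ length xs + length ys → Disjoint xs ys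
    disjoint eq (z∈xs , z∈ys) = All.lookup (subst (All.All (_∉ xs)) all-new (all-filter (_∉? xs) ys)) z∈ys z∈xs
      where
      all-new : filter (_∉? xs) ys ≡ ys
      all-new = filter-complete (_∉? xs) (+-cancelˡ-≡ (length xs) _ _ (trans (sym (length-++ xs)) eq))

    additive : Disjoint xs ys → length (xs ∪ ys) ≡ length xs + length ys
    additive xs#ys = trans (length-++ xs)
      (cong (λ l → length xs + length l) (filter-all (_∉? xs) (All.tabulate λ z∈ys z∈xs → xs#ys (z∈xs , z∈ys))))

open +-*-Solver

private
  variable
    m : ℕ

p-q≡r⇔p≡q+r : ∀ p q r → (p -ℚ q ≡ r) ⇔ (p ≡ q +ℚ r)
p-q≡r⇔p≡q+r p q r = mk⇔
  (λ { refl → solve 2 (λ p q → p := q :+ (p :- q)) refl p q })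
  (λ { refl → solve 2 (λ q r → (q :+ r) :- q := r) refl q r })

term : Bool → ℕ → ℚ
term b k = if b then recip k else 0ℚ

wsumB-∷ : ∀ k b (v : Vec Bool m) → wsumB k (b ∷ v) ≡ term b k +ℚ wsumB (suc k) v
wsumB-∷ k false v = refl
wsumB-∷ k true  v = refl

wsumB-∷ʳ : ∀ k (v : Vec Bool m) b → wsumB k (v ∷ʳ b) ≡ wsumB k v +ℚ term b (k + m)
wsumB-∷ʳ k [] b = begin
  wsumB k (b ∷ [])      ≡⟨ wsumB-∷ k b [] ⟩
  term b k +ℚ 0ℚ        ≡⟨ solve 1 (λ t → t :+ con 0ℚ := con 0ℚ :+ t) refl (term b k) ⟩
  0ℚ +ℚ term b k        ≡⟨ cong (λ j → 0ℚ +ℚ term b j) (sym (+-identityʳ k)) ⟩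
  0ℚ +ℚ term b (k + 0)  ∎
  where open ≡-Reasoning
wsumB-∷ʳ {suc m} k (x ∷ v) b = begin
  wsumB k (x ∷ (v ∷ʳ b))                                 ≡⟨ wsumB-∷ k x (v ∷ʳ b) ⟩
  term x k +ℚ wsumB (suc k) (v ∷ʳ b)                     ≡⟨ cong (term x k +ℚ_) (wsumB-∷ʳ (suc k) v b) ⟩
  term x k +ℚ (wsumB (suc k) v +ℚ term b (suc k + m))    ≡⟨ solve 3 (λ h s t → h :+ (s :+ t) := (h :+ s) :+ t) refl
                                                              (term x k) (wsumB (suc k) v) (term b (suc k + m)) ⟩
  (term x k +ℚ wsumB (suc k) v) +ℚ term b (suc k + m)    ≡⟨ cong₂ _+ℚ_ (sym (wsumB-∷ k x v)) (cong (term b) (sym (+-suc k m))) ⟩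
  wsumB k (x ∷ v) +ℚ term b (k + suc m)                  ∎
  where open ≡-Reasoning

infix 6 _−ᵇ_ _⊖_

_−ᵇ_ : Bool → Bool → Sign
true  −ᵇ false = pos
false −ᵇ true  = neg
_     −ᵇ _     = zer

_⊖_ : Vec Bool m → Vec Bool m → Vec Sign m
_⊖_ = zipWith _−ᵇ_

wsumS-−ᵇ : ∀ k x y (w : Vec Sign m) →
           wsumS k (x −ᵇ y ∷ w) ≡ (term x k -ℚ term y k) +ℚ wsumS (suc k) w
wsumS-−ᵇ k true  false w = solve 2 (λ r s → r :+ s := (r :- con 0ℚ) :+ s) refl (recip k) (wsumS (suc k) w)
wsumS-−ᵇ k false true  w = solve 2 (λ r s → (:- r) :+ s := (con 0ℚ :- r) :+ s) refl (recip k) (wsumS (suc k) w)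
wsumS-−ᵇ k true  true  w = solve 2 (λ r s → s := (r :- r) :+ s) refl (recip k) (wsumS (suc k) w)
wsumS-−ᵇ k false false w = solve 1 (λ s → s := (con 0ℚ :- con 0ℚ) :+ s) refl (wsumS (suc k) w)

wsumS-⊖ : ∀ k (v u : Vec Bool m) → wsumS k (v ⊖ u) ≡ wsumB k v -ℚ wsumB k u
wsumS-⊖ k [] [] = refl
wsumS-⊖ k (x ∷ v) (y ∷ u) = begin
  wsumS k (x −ᵇ y ∷ v ⊖ u)                           ≡⟨ wsumS-−ᵇ k x y (v ⊖ u) ⟩
  (tx -ℚ ty) +ℚ wsumS (suc k) (v ⊖ u)                ≡⟨ cong ((tx -ℚ ty) +ℚ_) (wsumS-⊖ (suc k) v u) ⟩
  (tx -ℚ ty) +ℚ (wsumB (suc k) v -ℚ wsumB (suc k) u)  ≡⟨ solve 4 (λ a b p q → (a :- b) :+ (p :- q) := (a :+ p) :- (b :+ q)) refl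
                                                          tx ty (wsumB (suc k) v) (wsumB (suc k) u) ⟩
  (tx +ℚ wsumB (suc k) v) -ℚ (ty +ℚ wsumB (suc k) u)  ≡⟨ sym (cong₂ _-ℚ_ (wsumB-∷ k x v) (wsumB-∷ k y u)) ⟩
  wsumB k (x ∷ v) -ℚ wsumB k (y ∷ u)                  ∎
  where
  open ≡-Reasoning
  tx = term x k
  ty = term y k

isPos isNeg : Sign → Bool
isPos pos = true
isPos _   = false
isNeg neg = true
isNeg _   = false

positives⊖negatives : (w : Vec Sign m) → Vec.map isPos w ⊖ Vec.map isNeg w ≡ w
positives⊖negatives []        = refl
positives⊖negatives (neg ∷ w) = cong (neg ∷_) (positives⊖negatives w)
positives⊖negatives (zer ∷ w) = cong (zer ∷_) (positives⊖negatives w)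
positives⊖negatives (pos ∷ w) = cong (pos ∷_) (positives⊖negatives w)

E : ℕ → List ℚ
E n = deduplicate _≟ℚ_ (EList n)

∈-allBoolVecs : (v : Vec Bool m) → v ∈ allBoolVecs m
∈-allBoolVecs []                  = here refl
∈-allBoolVecs {suc m} (false ∷ v) = ∈-++⁺ˡ (∈-map⁺ (false ∷_) (∈-allBoolVecs v))
∈-allBoolVecs {suc m} (true  ∷ v) = ∈-++⁺ʳ (map (false ∷_) (allBoolVecs m)) (∈-map⁺ (true ∷_) (∈-allBoolVecs v))

∈-E : ∀ {z} → z ∈ E m ⇔ (∃[ v ] wsumB {m} 0 v ≡ z)
∈-E {m} = ⇔.trans (⇔.sym (deduplicate-∈⇔ _≟ℚ_)) (mk⇔ witness (λ { (v , refl) → ∈-map⁺ (wsumB 0) (∈-allBoolVecs v) }))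
  where
  witness : ∀ {z} → z ∈ EList m → ∃[ v ] wsumB {m} 0 v ≡ z
  witness z∈ with ∈-map⁻ (wsumB 0) z∈
  ... | v , _ , refl = v , refl

E⁺ : ℕ → List ℚ
E⁺ m = map (_+ℚ recip m) (E m)

∈-E⁺ : ∀ {z} → z ∈ E⁺ m ⇔ (∃[ u ] wsumB {m} 0 u +ℚ recip m ≡ z)
∈-E⁺ {m} = mk⇔ witness member
  where
  witness : ∀ {z} → z ∈ E⁺ m → ∃[ u ] wsumB {m} 0 u +ℚ recip m ≡ z
  witness z∈ with ∈-map⁻ (_+ℚ recip m) z∈
  ... | y , y∈ , refl with to ∈-E y∈
  ...   | u , refl = u , refl
  member : ∀ {z} → ∃[ u ] wsumB {m} 0 u +ℚ recip m ≡ z → z ∈ E⁺ m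
  member (u , refl) = ∈-map⁺ (_+ℚ recip m) (from ∈-E (u , refl))

∈-E-suc : ∀ {z} → z ∈ E (suc m) ⇔ (z ∈ E m ⊎ z ∈ E⁺ m)
∈-E-suc {m} = ⇔.trans ∈-E (mk⇔ split join)
  where
  wsumB-∷ʳ-false : ∀ (u : Vec Bool m) → wsumB 0 (u ∷ʳ false) ≡ wsumB 0 u
  wsumB-∷ʳ-false u = trans (wsumB-∷ʳ 0 u false) (ℚ.+-identityʳ (wsumB 0 u))

  split : ∀ {z} → (∃[ v ] wsumB {suc m} 0 v ≡ z) → z ∈ E m ⊎ z ∈ E⁺ m
  split (v , refl) with initLast v
  ... | u , false , refl = inj₁ (from ∈-E (u , sym (wsumB-∷ʳ-false u)))
  ... | u , true  , refl = inj₂ (from ∈-E⁺ (u , sym (wsumB-∷ʳ 0 u true)))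

  join : ∀ {z} → z ∈ E m ⊎ z ∈ E⁺ m → ∃[ v ] wsumB {suc m} 0 v ≡ z
  join (inj₁ z∈) with to ∈-E z∈
  ... | u , refl = u ∷ʳ false , wsumB-∷ʳ-false u
  join (inj₂ z∈) with to ∈-E⁺ z∈
  ... | u , refl = u ∷ʳ true , wsumB-∷ʳ 0 u true

open Union _≟ℚ_

cardE-suc : ∀ m → cardE (suc m) ≡ length (E m ∪ E⁺ m)
cardE-suc m = Unique-set⇒length≡ (deduplicate-! (EList (suc m)))
  (∪-unique (deduplicate-! (EList m)) (Unique.map⁺ (cancelʳ (recip m) _ _) (deduplicate-! (EList m))))
  (⇔.trans ∈-E-suc (⇔.sym ∈-∪))

InU-suc⇔Disjoint : ∀ m → InU (suc m) ⇔ Disjoint (E m) (E⁺ m)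
InU-suc⇔Disjoint m = mk⇔ disjoint noSignedSum
  where
  disjoint : InU (suc m) → Disjoint (E m) (E⁺ m)
  disjoint inU (z∈E , z∈E⁺) with to ∈-E z∈E | to ∈-E⁺ z∈E⁺
  ... | v , refl | u , eq = inU (v ⊖ u) (trans (wsumS-⊖ 0 v u) (from (p-q≡r⇔p≡q+r _ _ _) (sym eq)))

  noSignedSum : Disjoint (E m) (E⁺ m) → InU (suc m)
  noSignedSum E#E⁺ w w≡ = E#E⁺ (from ∈-E (v , refl) , from ∈-E⁺ (u , sym (to (p-q≡r⇔p≡q+r _ _ _) v-u≡)))
    where
    v = Vec.map isPos w
    u = Vec.map isNeg w
    v-u≡ : wsumB 0 v -ℚ wsumB 0 u ≡ recip m
    v-u≡ = trans (sym (wsumS-⊖ 0 v u)) (trans (cong (wsumS 0) (positives⊖negatives w)) w≡)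

lemma1 : (N : ℕ) → 1 ≤ N → InU N ⇔ (cardE N ≡ 2 * cardE (N ∸ 1))
lemma1 (suc m) _ = subst₂ (λ l r → InU (suc m) ⇔ (l ≡ r)) (sym (cardE-suc m)) |E|+|E⁺|≡2|E|
  (⇔.trans (InU-suc⇔Disjoint m) (⇔.sym (length-∪⇔Disjoint (E m) (E⁺ m))))
  where
  |E|+|E⁺|≡2|E| : cardE m + length (E⁺ m) ≡ 2 * cardE m
  |E|+|E⁺|≡2|E| = cong (cardE m +_) (trans (length-map (_+ℚ recip m) (E m)) (sym (+-identityʳ (cardE m))))
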